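{- Let $\lambda_1,\lambda_2$ be integers with $\lambda_1\ge 5.8362\,\lambda_2>0$. Then $$C_{\lambda_1,\lambda_2}(-1,1):=\sum_{j=0}^{\lambda_2}(-1)^j\binom{\lambda_1}{j}\binom{\lambda_2}{j}\neq 0.$$ -}

module Defs where

open import Data.Nat using (ℕ; zero; suc)
open import Data.Nat.Combinatorics using (_C_)
open import Data.Integer using (ℤ; +_; _+_; _*_; -_)

sign : ℕ → ℤ
sign zero = + 1
sign (suc j) = - sign j

term : ℕ → ℕ → ℕ → ℤ
term l₁ l₂ j = sign j * + ((l₁ C j) Data.Nat.* (l₂ C j))

sumUpTo : (ℕ → ℤ) → ℕ → ℤ
sumUpTo f zero = f zero
sumUpTo f (suc m) = sumUpTo f m + f (suc m)

C-1-1 : ℕ → ℕ → ℤ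
C-1-1 l₁ l₂ = sumUpTo (term l₁ l₂) l₂

-- The coefficients c_k of f = (1 − x)^λ₁ (1 + x)^λ₂ satisfy the three-term recurrence coming from
-- (1 − x²) f′ = (λ₂ − λ₁ − (λ₁ + λ₂) x) f, and C_{λ₁,λ₂}(−1,1) = c_{λ₂}. Writing d = λ₁ − λ₂ and
-- q_k = (−1)^k c_k, the recurrence reads (k + 2) q_{k+2} + (λ₁ + λ₂ − k) q_k = d q_{k+1}, with
-- q₀ = 1 and q₁ = d. As long as 4 (k + 1) (λ₁ + λ₂ − k) ≤ d², the inequality
-- d q_k ≤ 2 (k + 1) q_{k+1} propagates from k to k + 1 and keeps every q_k positive. For k < λ₂
-- that condition follows from d ≥ (2 + 2√2) λ₂, and here d ≥ 4.8362 λ₂; hence q_{λ₂} > 0.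
module Submission where

open import Defs
open import Data.Nat.Combinatorics using (_C_; nCk+nC[k+1]≡[n+1]C[k+1]; nCk≡nC[n∸k])
open import Data.Product using (_×_; _,_; proj₂)
open import Relation.Binary.PropositionalEquality

module _ where
  open import Data.List using ([]; _∷_)
  open import Data.Nat
  open import Data.Nat.Properties
  open import Data.Nat.Tactic.RingSolver using (solve)

  m*m≤n*n⇒m≤n : ∀ {m n} → m * m ≤ n * n → m ≤ n
  m*m≤n*n⇒m≤n m*m≤n*n = ≮⇒≥ λ n<m → <⇒≱ (*-mono-< n<m n<m) m*m≤n*n

  ratio⇒≤ : ∀ p q m n .{{_ : NonZero q}} → q ≤ p → p * m ≤ q * n → m ≤ n
  ratio⇒≤ p q m n q≤p pm≤qn = *-cancelˡ-≤ q (≤-trans (*-monoˡ-≤ m q≤p) pm≤qn)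

  -- p² ≥ 4q(p + q) says p/q ≥ 2 + 2√2, the larger root of x² = 4x + 4.
  quadratic-bound : ∀ p q N d .{{_ : NonZero q}} →
                    4 * q * (p + q) ≤ p * p → p * N ≤ q * d → 4 * N * (d + N) ≤ d * d
  quadratic-bound p q N d 4q[p+q]≤p² pN≤qd with m≤n⇒∃[o]m+o≡n pN≤qd
  ... | r , pN+r≡qd = *-cancelˡ-≤ (q * q) {{m*n≢0 q q}} (begin
    q * q * (4 * N * (d + N))                        ≡⟨ solve (q ∷ N ∷ d ∷ []) ⟩
    4 * q * N * (q * d) + 4 * (q * q) * (N * N)      ≡⟨ cong (λ e → 4 * q * N * e + 4 * (q * q) * (N * N)) pN+r≡qd ⟨
    4 * q * N * (p * N + r) + 4 * (q * q) * (N * N)  ≡⟨ solve (p ∷ q ∷ N ∷ r ∷ []) ⟩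
    4 * q * (p + q) * (N * N) + 2 * (2 * q) * N * r  ≤⟨ +-mono-≤ (*-monoˡ-≤ (N * N) 4q[p+q]≤p²)
                                                                  (*-monoˡ-≤ r (*-monoˡ-≤ N (*-monoʳ-≤ 2 2q≤p))) ⟩
    p * p * (N * N) + 2 * p * N * r                  ≤⟨ m≤m+n _ (r * r) ⟩
    p * p * (N * N) + 2 * p * N * r + r * r          ≡⟨ solve (p ∷ N ∷ r ∷ []) ⟩
    (p * N + r) * (p * N + r)                        ≡⟨ cong₂ _*_ pN+r≡qd pN+r≡qd ⟩
    (q * d) * (q * d)                                ≡⟨ solve (q ∷ d ∷ []) ⟩
    q * q * (d * d)                                  ∎)
    where
    open ≤-Reasoning
    2q≤p : 2 * q ≤ p
    2q≤p = m*m≤n*n⇒m≤n (begin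
      2 * q * (2 * q)  ≡⟨ solve (q ∷ []) ⟩
      4 * q * q        ≤⟨ *-monoʳ-≤ (4 * q) (m≤n+m q p) ⟩
      4 * q * (p + q)  ≤⟨ 4q[p+q]≤p² ⟩
      p * p            ∎)

  -- With K = 1 + k and m = 1 + n the left side is K (2m + d + 1 − K), which stays below m (d + m) for K < m ≤ d.
  product-bound : ∀ {n k} d → k < n → suc n ≤ d → suc k * (suc n + (suc n + d) ∸ k) ≤ suc n * (d + suc n)
  product-bound {k = k} d k<n 1+n≤d with m≤n⇒∃[o]m+o≡n k<n
  ... | t , refl = +-cancelʳ-≤ (suc k) _ _ (begin
    suc k * (2 + k + t + (2 + k + t + d) ∸ k) + suc k  ≡⟨ cong (λ b → suc k * b + suc k) b≡d+k+4+2t ⟩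
    suc k * (d + k + 4 + 2 * t) + suc k                ≤⟨ +-monoʳ-≤ _ 1+k≤[1+t][d+1+t] ⟩
    suc k * (d + k + 4 + 2 * t) + suc t * (d + suc t)  ≡⟨ solve (k ∷ t ∷ d ∷ []) ⟩
    (2 + k + t) * (d + (2 + k + t)) + suc k            ∎)
    where
    open ≤-Reasoning
    m+[m+d]≡k+[d+k+4+2t] : 2 + k + t + (2 + k + t + d) ≡ k + (d + k + 4 + 2 * t)
    m+[m+d]≡k+[d+k+4+2t] = solve (k ∷ t ∷ d ∷ [])
    b≡d+k+4+2t : 2 + k + t + (2 + k + t + d) ∸ k ≡ d + k + 4 + 2 * t
    b≡d+k+4+2t = trans (cong (_∸ k) m+[m+d]≡k+[d+k+4+2t]) (m+n∸m≡n k (d + k + 4 + 2 * t))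
    1+k≤[1+t][d+1+t] : suc k ≤ suc t * (d + suc t)
    1+k≤[1+t][d+1+t] = begin
      suc k                ≤⟨ m≤m+n (suc k) (suc t) ⟩
      suc k + suc t        ≡⟨ +-suc (suc k) t ⟩
      2 + k + t            ≤⟨ 1+n≤d ⟩
      d                    ≤⟨ m≤m+n d (suc t) ⟩
      d + suc t            ≤⟨ m≤n*m (d + suc t) (suc t) ⟩
      suc t * (d + suc t)  ∎

  coefficient-bound : ∀ {n k} d → k < n → 48362 * suc n ≤ 10000 * d →
                      4 * suc k * (suc n + (suc n + d) ∸ k) ≤ d * d
  coefficient-bound {n} {k} d k<n 48362m≤10000d = begin
    4 * suc k * b                ≡⟨ *-assoc 4 (suc k) b ⟩
    4 * (suc k * b)              ≤⟨ *-monoʳ-≤ 4 (product-bound d k<n m≤d) ⟩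
    4 * (suc n * (d + suc n))    ≡⟨ *-assoc 4 (suc n) (d + suc n) ⟨
    4 * suc n * (d + suc n)      ≤⟨ quadratic-bound 48362 10000 (suc n) d (≤ᵇ⇒≤ _ _ _) 48362m≤10000d ⟩
    d * d                        ∎
    where
    open ≤-Reasoning
    b : ℕ
    b = suc n + (suc n + d) ∸ k
    m≤d : suc n ≤ d
    m≤d = ratio⇒≤ 48362 10000 (suc n) d (≤ᵇ⇒≤ _ _ _) 48362m≤10000d

  58362m≤10000n⇒48362m≤10000[n∸m] : ∀ m n → 58362 * m ≤ 10000 * n → 48362 * m ≤ 10000 * (n ∸ m)
  58362m≤10000n⇒48362m≤10000[n∸m] m n 58362m≤10000n = +-cancelˡ-≤ (10000 * m) _ _ (begin
    10000 * m + 48362 * m        ≡⟨ *-distribʳ-+ m 10000 48362 ⟨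
    58362 * m                    ≤⟨ 58362m≤10000n ⟩
    10000 * n                    ≡⟨ cong (10000 *_) (m+[n∸m]≡n m≤n) ⟨
    10000 * (m + (n ∸ m))        ≡⟨ *-distribˡ-+ 10000 m (n ∸ m) ⟩
    10000 * m + 10000 * (n ∸ m)  ∎)
    where
    open ≤-Reasoning
    m≤n : m ≤ n
    m≤n = ratio⇒≤ 58362 10000 m n (≤ᵇ⇒≤ _ _ _) 58362m≤10000n

open import Data.Integer using (ℤ; +_; _+_; _*_; -_; _-_; _≤_; _<_; +≤+; +<+; positive; nonNegative)
import Data.Integer.Properties as ℤ
open import Data.Integer.Tactic.RingSolver using (solve; solve-∀)
open import Data.List using ([]; _∷_)
open import Data.Nat as ℕ using (ℕ; zero; suc; _∸_)
import Data.Nat.Properties as ℕ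

-- Power series over ℤ, as coefficient sequences.
Seq : Set
Seq = ℕ → ℤ

one : Seq
one zero    = + 1
one (suc _) = + 0

[1+x]·_ : Seq → Seq
([1+x]· c) zero    = c zero
([1+x]· c) (suc k) = c (suc k) + c k

[1-x]·_ : Seq → Seq
([1-x]· c) zero    = c zero
([1-x]· c) (suc k) = c (suc k) - c k

-- c(−x)
alternate : Seq → Seq
alternate c k = sign k * c k

[1+x]^_ : ℕ → Seq
[1+x]^ zero  = one
[1+x]^ suc m = [1+x]· ([1+x]^ m)

[1-x]^_·_ : ℕ → Seq → Seq
[1-x]^ zero  · c = c
[1-x]^ suc a · c = [1-x]· ([1-x]^ a · c)

-- Coefficient of x^k in (1 − x²) f′ − (M − A − (A + M) x) f, which vanishes for f = (1 − x)^A (1 + x)^M.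
residual : ℤ → ℤ → Seq → Seq
residual A M c zero    = c 1 - (M - A) * c 0
residual A M c (suc k) = + suc (suc k) * c (suc (suc k)) + (A + M - + k) * c k - (M - A) * c (suc k)

Recurrence : ℤ → ℤ → Seq → Set
Recurrence A M c = ∀ k → residual A M c k ≡ + 0

residual-[1+x]· : ∀ A M c k → residual A (+ 1 + M) ([1+x]· c) k ≡ ([1+x]· residual A M c) k
residual-[1+x]· A M c zero                = identity₀ A M (c 0) (c 1)
  where
  identity₀ : ∀ A M c₀ c₁ → (c₁ + c₀) - ((+ 1 + M) - A) * c₀ ≡ c₁ - (M - A) * c₀
  identity₀ = solve-∀
residual-[1+x]· A M c (suc zero)          = identity₁ A M (c 0) (c 1) (c 2)
  where
  identity₁ : ∀ A M c₀ c₁ c₂ →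
              + 2 * (c₂ + c₁) + (A + (+ 1 + M) - + 0) * c₀ - ((+ 1 + M) - A) * (c₁ + c₀)
              ≡ (+ 2 * c₂ + (A + M - + 0) * c₀ - (M - A) * c₁) + (c₁ - (M - A) * c₀)
  identity₁ = solve-∀
residual-[1+x]· A M c (suc (suc k)) = identity A M (+ k) (c k) (c (1 ℕ.+ k)) (c (2 ℕ.+ k)) (c (3 ℕ.+ k))
  where
  identity : ∀ A M K c₀ c₁ c₂ c₃ →
             (+ 3 + K) * (c₃ + c₂) + (A + (+ 1 + M) - (+ 1 + K)) * (c₁ + c₀) - ((+ 1 + M) - A) * (c₂ + c₁)
             ≡ ((+ 3 + K) * c₃ + (A + M - (+ 1 + K)) * c₁ - (M - A) * c₂)
               + ((+ 2 + K) * c₂ + (A + M - K) * c₀ - (M - A) * c₁)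
  identity = solve-∀

residual-[1-x]· : ∀ A M c k → residual (+ 1 + A) M ([1-x]· c) k ≡ ([1-x]· residual A M c) k
residual-[1-x]· A M c zero                = identity₀ A M (c 0) (c 1)
  where
  identity₀ : ∀ A M c₀ c₁ → (c₁ - c₀) - (M - (+ 1 + A)) * c₀ ≡ c₁ - (M - A) * c₀
  identity₀ = solve-∀
residual-[1-x]· A M c (suc zero)          = identity₁ A M (c 0) (c 1) (c 2)
  where
  identity₁ : ∀ A M c₀ c₁ c₂ →
              + 2 * (c₂ - c₁) + ((+ 1 + A) + M - + 0) * c₀ - (M - (+ 1 + A)) * (c₁ - c₀)
              ≡ (+ 2 * c₂ + (A + M - + 0) * c₀ - (M - A) * c₁) - (c₁ - (M - A) * c₀)
  identity₁ = solve-∀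
residual-[1-x]· A M c (suc (suc k)) = identity A M (+ k) (c k) (c (1 ℕ.+ k)) (c (2 ℕ.+ k)) (c (3 ℕ.+ k))
  where
  identity : ∀ A M K c₀ c₁ c₂ c₃ →
             (+ 3 + K) * (c₃ - c₂) + ((+ 1 + A) + M - (+ 1 + K)) * (c₁ - c₀) - (M - (+ 1 + A)) * (c₂ - c₁)
             ≡ ((+ 3 + K) * c₃ + (A + M - (+ 1 + K)) * c₁ - (M - A) * c₂)
               - ((+ 2 + K) * c₂ + (A + M - K) * c₀ - (M - A) * c₁)
  identity = solve-∀

residual-alternate : ∀ A M c k → residual M A (alternate c) k ≡ - alternate (residual A M c) k
residual-alternate A M c zero    = identity₀ A M (c 0) (c 1)
  where
  identity₀ : ∀ A M c₀ c₁ → - + 1 * c₁ - (A - M) * (+ 1 * c₀) ≡ - (+ 1 * (c₁ - (M - A) * c₀))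
  identity₀ = solve-∀
residual-alternate A M c (suc k) = identity A M (+ k) (sign k) (c k) (c (suc k)) (c (suc (suc k)))
  where
  identity : ∀ A M K s c₀ c₁ c₂ →
             (+ 2 + K) * (- - s * c₂) + (M + A - K) * (s * c₀) - (A - M) * (- s * c₁)
             ≡ - (- s * ((+ 2 + K) * c₂ + (A + M - K) * c₀ - (M - A) * c₁))
  identity = solve-∀

recurrence-one : Recurrence (+ 0) (+ 0) one
recurrence-one zero          = refl
recurrence-one (suc zero)    = refl
recurrence-one (suc (suc k)) = identity (+ 3 + + k) (+ 0 + + 0 - + suc k) (+ 0 - + 0)
  where
  identity : ∀ X Y Z → X * + 0 + Y * + 0 - Z * + 0 ≡ + 0
  identity = solve-∀

recurrence-[1+x]· : ∀ {A M c} → Recurrence A M c → Recurrence A (+ 1 + M) ([1+x]· c)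
recurrence-[1+x]· {A} {M} {c} rec zero    = trans (residual-[1+x]· A M c zero) (rec zero)
recurrence-[1+x]· {A} {M} {c} rec (suc k) =
  trans (residual-[1+x]· A M c (suc k)) (cong₂ _+_ (rec (suc k)) (rec k))

recurrence-[1-x]· : ∀ {A M c} → Recurrence A M c → Recurrence (+ 1 + A) M ([1-x]· c)
recurrence-[1-x]· {A} {M} {c} rec zero    = trans (residual-[1-x]· A M c zero) (rec zero)
recurrence-[1-x]· {A} {M} {c} rec (suc k) =
  trans (residual-[1-x]· A M c (suc k)) (cong₂ _-_ (rec (suc k)) (rec k))

recurrence-alternate : ∀ {A M c} → Recurrence A M c → Recurrence M A (alternate c)
recurrence-alternate {A} {M} {c} rec k = begin
  residual M A (alternate c) k        ≡⟨ residual-alternate A M c k ⟩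
  - (sign k * residual A M c k)       ≡⟨ cong (λ r → - (sign k * r)) (rec k) ⟩
  - (sign k * + 0)                    ≡⟨ cong -_ (ℤ.*-zeroʳ (sign k)) ⟩
  + 0                                 ∎
  where open ≡-Reasoning

recurrence-[1+x]^ : ∀ m → Recurrence (+ 0) (+ m) ([1+x]^ m)
recurrence-[1+x]^ zero    = recurrence-one
recurrence-[1+x]^ (suc m) = recurrence-[1+x]· (recurrence-[1+x]^ m)

recurrence-[1-x]^[1+x]^ : ∀ a m → Recurrence (+ a) (+ m) ([1-x]^ a · ([1+x]^ m))
recurrence-[1-x]^[1+x]^ zero    m = recurrence-[1+x]^ m
recurrence-[1-x]^[1+x]^ (suc a) m = recurrence-[1-x]· (recurrence-[1-x]^[1+x]^ a m)

sumUpTo-cong : ∀ {f g} n → (∀ {j} → j ℕ.≤ n → f j ≡ g j) → sumUpTo f n ≡ sumUpTo g n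
sumUpTo-cong zero    f≗g = f≗g ℕ.z≤n
sumUpTo-cong (suc n) f≗g = cong₂ _+_ (sumUpTo-cong n (λ j≤n → f≗g (ℕ.m≤n⇒m≤1+n j≤n))) (f≗g ℕ.≤-refl)

sumUpTo-zero : ∀ n → sumUpTo (λ _ → + 0) n ≡ + 0
sumUpTo-zero zero    = refl
sumUpTo-zero (suc n) = cong (_+ + 0) (sumUpTo-zero n)

sumUpTo-shift : ∀ f n → sumUpTo f (suc n) ≡ f 0 + sumUpTo (λ j → f (suc j)) n
sumUpTo-shift f zero    = refl
sumUpTo-shift f (suc n) = trans (cong (_+ f (suc (suc n))) (sumUpTo-shift f n)) (ℤ.+-assoc (f 0) _ _)

sumUpTo-minus : ∀ f g n → sumUpTo (λ j → f j - g j) n ≡ sumUpTo f n - sumUpTo g n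
sumUpTo-minus f g zero    = refl
sumUpTo-minus f g (suc n) = trans (cong (_+ (f (suc n) - g (suc n))) (sumUpTo-minus f g n))
                                  (identity (sumUpTo f n) (sumUpTo g n) (f (suc n)) (g (suc n)))
  where
  identity : ∀ a b c d → (a - b) + (c - d) ≡ (a + c) - (b + d)
  identity = solve-∀

alternatingConvolution : ℕ → Seq → Seq
alternatingConvolution a g k = sumUpTo (λ j → sign j * + (a C j) * g (k ∸ j)) k

alternatingConvolution-zero : ∀ g k → alternatingConvolution 0 g k ≡ g k
alternatingConvolution-zero g zero    = ℤ.*-identityˡ (g 0)
alternatingConvolution-zero g (suc k) = begin
  alternatingConvolution 0 g (suc k)
    ≡⟨ sumUpTo-shift _ k ⟩
  + 1 * + 1 * g (suc k) + sumUpTo (λ j → sign (suc j) * + 0 * g (k ∸ j)) k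
    ≡⟨ cong₂ _+_ (ℤ.*-identityˡ (g (suc k)))
                 (sumUpTo-cong k (λ {j} _ → cong (_* g (k ∸ j)) (ℤ.*-zeroʳ (sign (suc j))))) ⟩
  g (suc k) + sumUpTo (λ _ → + 0) k
    ≡⟨ cong (λ s → g (suc k) + s) (sumUpTo-zero k) ⟩
  g (suc k) + + 0
    ≡⟨ ℤ.+-identityʳ (g (suc k)) ⟩
  g (suc k) ∎
  where open ≡-Reasoning

alternatingConvolution-suc : ∀ a g k →
  alternatingConvolution (suc a) g (suc k) ≡ alternatingConvolution a g (suc k) - alternatingConvolution a g k
alternatingConvolution-suc a g k = begin
  alternatingConvolution (suc a) g (suc k)
    ≡⟨ sumUpTo-shift _ k ⟩
  u 0 + sumUpTo (λ j → sign (suc j) * + (suc a C suc j) * g (k ∸ j)) k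
    ≡⟨ cong (λ s → u 0 + s) (trans (sumUpTo-cong k (λ {j} _ → pascal j)) (sumUpTo-minus _ v k)) ⟩
  u 0 + (sumUpTo (λ j → u (suc j)) k - sumUpTo v k)
    ≡⟨ ℤ.+-assoc (u 0) _ _ ⟨
  (u 0 + sumUpTo (λ j → u (suc j)) k) - sumUpTo v k
    ≡⟨ cong (_- sumUpTo v k) (sumUpTo-shift u k) ⟨
  alternatingConvolution a g (suc k) - alternatingConvolution a g k ∎
  where
  open ≡-Reasoning
  u v : Seq
  u j = sign j * + (a C j) * g (suc k ∸ j)
  v j = sign j * + (a C j) * g (k ∸ j)
  identity : ∀ s X Y z → - s * (X + Y) * z ≡ - s * Y * z - s * X * z
  identity = solve-∀
  pascal : ∀ j → sign (suc j) * + (suc a C suc j) * g (k ∸ j) ≡ u (suc j) - v j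
  pascal j = begin
    - sign j * + (suc a C suc j) * g (k ∸ j)
      ≡⟨ cong (λ n → - sign j * + n * g (k ∸ j)) (nCk+nC[k+1]≡[n+1]C[k+1] a j) ⟨
    - sign j * + (a C j ℕ.+ a C suc j) * g (k ∸ j)
      ≡⟨ cong (λ n → - sign j * n * g (k ∸ j)) (ℤ.pos-+ (a C j) (a C suc j)) ⟩
    - sign j * (+ (a C j) + + (a C suc j)) * g (k ∸ j)
      ≡⟨ identity (sign j) (+ (a C j)) (+ (a C suc j)) (g (k ∸ j)) ⟩
    u (suc j) - v j ∎

[1-x]^·-expansion : ∀ a g k → ([1-x]^ a · g) k ≡ alternatingConvolution a g k
[1-x]^·-expansion zero    g k       = sym (alternatingConvolution-zero g k)
[1-x]^·-expansion (suc a) g zero    = [1-x]^·-expansion a g zero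
[1-x]^·-expansion (suc a) g (suc k) = trans (cong₂ _-_ ([1-x]^·-expansion a g (suc k)) ([1-x]^·-expansion a g k))
                                            (sym (alternatingConvolution-suc a g k))

[1-x]^·-constant : ∀ a c → ([1-x]^ a · c) 0 ≡ c 0
[1-x]^·-constant zero    c = refl
[1-x]^·-constant (suc a) c = [1-x]^·-constant a c

[1+x]^-coefficient : ∀ m k → ([1+x]^ m) k ≡ + (m C k)
[1+x]^-coefficient zero    zero    = refl
[1+x]^-coefficient zero    (suc k) = refl
[1+x]^-coefficient (suc m) zero    = [1+x]^-coefficient m zero
[1+x]^-coefficient (suc m) (suc k) = begin
  ([1+x]^ m) (suc k) + ([1+x]^ m) k  ≡⟨ cong₂ _+_ ([1+x]^-coefficient m (suc k)) ([1+x]^-coefficient m k) ⟩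
  + (m C suc k) + + (m C k)          ≡⟨ ℤ.pos-+ (m C suc k) (m C k) ⟨
  + (m C suc k ℕ.+ m C k)            ≡⟨ cong +_ (trans (ℕ.+-comm (m C suc k) (m C k)) (nCk+nC[k+1]≡[n+1]C[k+1] m k)) ⟩
  + (suc m C suc k)                  ∎
  where open ≡-Reasoning

[1-x]^[1+x]^-diagonal : ∀ a m → ([1-x]^ a · ([1+x]^ m)) m ≡ C-1-1 a m
[1-x]^[1+x]^-diagonal a m = trans ([1-x]^·-expansion a ([1+x]^ m) m) (sumUpTo-cong m symmetric-term)
  where
  open ≡-Reasoning
  symmetric-term : ∀ {j} → j ℕ.≤ m → sign j * + (a C j) * ([1+x]^ m) (m ∸ j) ≡ term a m j
  symmetric-term {j} j≤m = begin
    sign j * + (a C j) * ([1+x]^ m) (m ∸ j)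
      ≡⟨ cong (sign j * + (a C j) *_) ([1+x]^-coefficient m (m ∸ j)) ⟩
    sign j * + (a C j) * + (m C (m ∸ j))
      ≡⟨ cong (λ n → sign j * + (a C j) * + n) (nCk≡nC[n∸k] j≤m) ⟨
    sign j * + (a C j) * + (m C j)
      ≡⟨ ℤ.*-assoc (sign j) (+ (a C j)) (+ (m C j)) ⟩
    sign j * (+ (a C j) * + (m C j))
      ≡⟨ cong (sign j *_) (ℤ.pos-* (a C j) (m C j)) ⟨
    term a m j ∎

*-positive : ∀ {i j} → + 0 < i → + 0 < j → + 0 < i * j
*-positive {i} {j} 0<i 0<j = subst (_< i * j) (ℤ.*-zeroʳ i) (ℤ.*-monoˡ-<-pos i {{positive 0<i}} 0<j)

-- One step of the ratio invariant: 2b q₀ ≤ d q₁ follows by comparing d·(2b q₀) with d·(d q₁),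
-- and then 2(k + 1) q₂ = 2 d q₁ − 2b q₀ ≥ d q₁.
ratio-step : ∀ {d b k q₀ q₁ q₂} → + 0 < d → + 0 ≤ b → + 0 < q₁ →
             + 4 * k * b ≤ d * d →
             d * q₀ ≤ + 2 * k * q₁ →
             (+ 1 + k) * q₂ + b * q₀ ≡ d * q₁ →
             d * q₁ ≤ + 2 * (+ 1 + k) * q₂
ratio-step {d} {b} {k} {q₀} {q₁} {q₂} 0<d 0≤b 0<q₁ 4kb≤d² dq₀≤2kq₁ recurrence = begin
  d * q₁                            ≤⟨ ℤ.i≤i+j (d * q₁) _ {{nonNegative (ℤ.i≤j⇒0≤j-i 2bq₀≤dq₁)}} ⟩
  d * q₁ + (d * q₁ - + 2 * b * q₀)  ≡⟨ cong (λ x → x + (x - + 2 * b * q₀)) recurrence ⟨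
  (+ 1 + k) * q₂ + b * q₀ + ((+ 1 + k) * q₂ + b * q₀ - + 2 * b * q₀)  ≡⟨ solve (k ∷ q₂ ∷ b ∷ q₀ ∷ []) ⟩
  + 2 * (+ 1 + k) * q₂              ∎
  where
  open ℤ.≤-Reasoning
  2bq₀≤dq₁ : + 2 * b * q₀ ≤ d * q₁
  2bq₀≤dq₁ = ℤ.*-cancelˡ-≤-pos (+ 2 * b * q₀) (d * q₁) d {{positive 0<d}} (begin
    d * (+ 2 * b * q₀)          ≡⟨ solve (d ∷ b ∷ q₀ ∷ []) ⟩
    + 2 * (b * (d * q₀))        ≤⟨ ℤ.*-monoˡ-≤-nonNeg (+ 2) (ℤ.*-monoˡ-≤-nonNeg b {{nonNegative 0≤b}} dq₀≤2kq₁) ⟩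
    + 2 * (b * (+ 2 * k * q₁))  ≡⟨ solve (b ∷ k ∷ q₁ ∷ []) ⟩
    + 4 * k * b * q₁            ≤⟨ ℤ.*-monoʳ-≤-nonNeg q₁ {{nonNegative (ℤ.<⇒≤ 0<q₁)}} 4kb≤d² ⟩
    d * d * q₁                  ≡⟨ ℤ.*-assoc d d q₁ ⟩
    d * (d * q₁)                ∎)

recurrence-positive : ∀ {A M q} n → Recurrence A M q → + 0 < q 0 → + 0 < M - A →
                      (∀ {k} → k ℕ.< n → + 0 ≤ A + M - + k) →
                      (∀ {k} → k ℕ.< n → + 4 * + suc k * (A + M - + k) ≤ (M - A) * (M - A)) →
                      + 0 < q (suc n)
recurrence-positive {A} {M} {q} n recurrence 0<q₀ 0<d 0≤b 4kb≤d² = positive-next (ratio n ℕ.≤-refl)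
  where
  d : ℤ
  d = M - A

  Ratio : ℕ → Set
  Ratio j = + 0 < q j × d * q j ≤ + 2 * + suc j * q (suc j)

  positive-next : ∀ {j} → Ratio j → + 0 < q (suc j)
  positive-next {j} (0<qⱼ , dqⱼ≤2[j+1]qⱼ₊₁) =
    ℤ.*-cancelˡ-<-nonNeg (+ 2 * + suc j)
      (subst (_< + 2 * + suc j * q (suc j)) (sym (ℤ.*-zeroʳ (+ 2 * + suc j)))
             (ℤ.<-≤-trans (*-positive 0<d 0<qⱼ) dqⱼ≤2[j+1]qⱼ₊₁))

  ratio : ∀ j → j ℕ.≤ n → Ratio j
  ratio zero    _   = 0<q₀ , (begin
    d * q 0            ≤⟨ ℤ.i≤i+j (d * q 0) _ {{nonNegative (ℤ.<⇒≤ (*-positive 0<d 0<q₀))}} ⟩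
    d * q 0 + d * q 0  ≡⟨ double (d * q 0) ⟩
    + 2 * (d * q 0)    ≡⟨ cong (+ 2 *_) (ℤ.i-j≡0⇒i≡j _ _ (recurrence 0)) ⟨
    + 2 * q 1          ∎)
    where
    open ℤ.≤-Reasoning
    double : ∀ x → x + x ≡ + 2 * x
    double = solve-∀
  ratio (suc j) j<n =
    positive-next rⱼ ,
    ratio-step {k = + suc j} {q₂ = q (suc (suc j))} 0<d (0≤b j<n) (positive-next rⱼ) (4kb≤d² j<n) (proj₂ rⱼ)
               (ℤ.i-j≡0⇒i≡j _ _ (recurrence (suc j)))
    where
    rⱼ : Ratio j
    rⱼ = ratio j (ℕ.<⇒≤ j<n)

+m-+n≡+[m∸n] : ∀ {m n} → n ℕ.≤ m → + m - + n ≡ + (m ∸ n)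
+m-+n≡+[m∸n] {m} {n} n≤m = trans (ℤ.m-n≡m⊖n m n) (ℤ.⊖-≥ n≤m)

+[m+n]-+m≡+n : ∀ m n → + (m ℕ.+ n) - + m ≡ + n
+[m+n]-+m≡+n m n = trans (+m-+n≡+[m∸n] (ℕ.m≤m+n m n)) (cong +_ (ℕ.m+n∸m≡n m n))

recurrence-coefficient : ∀ {n k} d → k ℕ.< n → + suc n + + (suc n ℕ.+ d) - + k ≡ + (suc n ℕ.+ (suc n ℕ.+ d) ∸ k)
recurrence-coefficient d k<n = +m-+n≡+[m∸n] (ℕ.m≤n⇒m≤n+o _ (ℕ.m≤n⇒m≤1+n (ℕ.<⇒≤ k<n)))

recurrence-coefficient-bound : ∀ {n k} d → k ℕ.< n → 48362 ℕ.* suc n ℕ.≤ 10000 ℕ.* d →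
  + 4 * + suc k * (+ suc n + + (suc n ℕ.+ d) - + k) ≤ (+ (suc n ℕ.+ d) - + suc n) * (+ (suc n ℕ.+ d) - + suc n)
recurrence-coefficient-bound {n} {k} d k<n 48362λ₂≤10000d = begin
  + 4 * + suc k * (+ suc n + + (suc n ℕ.+ d) - + k)      ≡⟨ cong (+ 4 * + suc k *_) (recurrence-coefficient d k<n) ⟩
  + 4 * + suc k * + (suc n ℕ.+ (suc n ℕ.+ d) ∸ k)       ≡⟨ ℤ.pos-* (4 ℕ.* suc k) _ ⟨
  + (4 ℕ.* suc k ℕ.* (suc n ℕ.+ (suc n ℕ.+ d) ∸ k))     ≤⟨ +≤+ (coefficient-bound d k<n 48362λ₂≤10000d) ⟩
  + (d ℕ.* d)                                          ≡⟨ ℤ.pos-* d d ⟩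
  + d * + d                                            ≡⟨ cong₂ _*_ d≡ d≡ ⟨
  (+ (suc n ℕ.+ d) - + suc n) * (+ (suc n ℕ.+ d) - + suc n) ∎
  where
  open ℤ.≤-Reasoning
  d≡ : + (suc n ℕ.+ d) - + suc n ≡ + d
  d≡ = +[m+n]-+m≡+n (suc n) d

alternating-coefficient-positive : ∀ n d → 48362 ℕ.* suc n ℕ.≤ 10000 ℕ.* d →
  + 0 < alternate ([1-x]^ (suc n ℕ.+ d) · ([1+x]^ suc n)) (suc n)
alternating-coefficient-positive n d 48362λ₂≤10000d =
  recurrence-positive n (recurrence-alternate (recurrence-[1-x]^[1+x]^ (suc n ℕ.+ d) (suc n)))
    0<q₀ 0<d
    (λ k<n → subst (+ 0 ≤_) (sym (recurrence-coefficient d k<n)) (+≤+ ℕ.z≤n))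
    (λ k<n → recurrence-coefficient-bound d k<n 48362λ₂≤10000d)
  where
  0<q₀ : + 0 < alternate ([1-x]^ (suc n ℕ.+ d) · ([1+x]^ suc n)) 0
  0<q₀ = subst (+ 0 <_) q₀≡1 (+<+ ℕ.z<s)
    where
    open ≡-Reasoning
    q₀≡1 : + 1 ≡ alternate ([1-x]^ (suc n ℕ.+ d) · ([1+x]^ suc n)) 0
    q₀≡1 = sym (begin
      + 1 * ([1-x]^ (suc n ℕ.+ d) · ([1+x]^ suc n)) 0 ≡⟨ ℤ.*-identityˡ _ ⟩
      ([1-x]^ (suc n ℕ.+ d) · ([1+x]^ suc n)) 0       ≡⟨ [1-x]^·-constant (suc n ℕ.+ d) ([1+x]^ suc n) ⟩
      ([1+x]^ suc n) 0                               ≡⟨ [1+x]^-coefficient (suc n) 0 ⟩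
      + 1                                            ∎)
  0<d : + 0 < + (suc n ℕ.+ d) - + suc n
  0<d = subst (+ 0 <_) (sym (+[m+n]-+m≡+n (suc n) d))
               (+<+ (ℕ.<-≤-trans ℕ.z<s (ratio⇒≤ 48362 10000 (suc n) d (ℕ.≤ᵇ⇒≤ _ _ _) 48362λ₂≤10000d)))

C-1-1-nonzero : ∀ n d → 48362 ℕ.* suc n ℕ.≤ 10000 ℕ.* d → C-1-1 (suc n ℕ.+ d) (suc n) ≢ + 0
C-1-1-nonzero n d 48362λ₂≤10000d C≡0 =
  ℤ.<-irrefl (sym alternate-vanishes) (alternating-coefficient-positive n d 48362λ₂≤10000d)
  where
  alternate-vanishes : alternate ([1-x]^ (suc n ℕ.+ d) · ([1+x]^ suc n)) (suc n) ≡ + 0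
  alternate-vanishes = trans (cong (sign (suc n) *_) (trans ([1-x]^[1+x]^-diagonal (suc n ℕ.+ d) (suc n)) C≡0))
                             (ℤ.*-zeroʳ (sign (suc n)))

theorem5 : (l₁ l₂ : ℕ) → 0 ℕ.< l₂ → 58362 ℕ.* l₂ ℕ.≤ 10000 ℕ.* l₁ → C-1-1 l₁ l₂ ≢ + 0
theorem5 l₁ (suc n) _ 58362λ₂≤10000λ₁ =
  subst (λ l → C-1-1 l (suc n) ≢ + 0) (ℕ.m+[n∸m]≡n λ₂≤λ₁)
        (C-1-1-nonzero n (l₁ ∸ suc n) (58362m≤10000n⇒48362m≤10000[n∸m] (suc n) l₁ 58362λ₂≤10000λ₁))
  where
  λ₂≤λ₁ : suc n ℕ.≤ l₁
  λ₂≤λ₁ = ratio⇒≤ 58362 10000 (suc n) l₁ (ℕ.≤ᵇ⇒≤ _ _ _) 58362λ₂≤10000λ₁
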